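{- Let $b$ be a real with $0<b\le\frac13$. Let $G$ be a $3$-uniform star, i.e. a $3$-graph all of whose edges contain a common vertex. Then $\lambda_b(G)\le\frac12 b(1-b)^2$.
   Context: For a $3$-graph $G$ on $[n]$ and $\vec x\in[0,\infty)^n$, $\lambda(G,\vec x)=\sum_{e\in E(G)}\prod_{i\in e}x_i$. A feasible weight vector satisfies $\vec x\ge0$, $\sum_ix_i=1$; it is $b$-bounded if all $x_i\le b$. $\lambda_b(G)$ is the maximum of $\lambda(G,\vec x)$ over $b$-bounded feasible $\vec x$ (and $0$ if none exists). -}

module Defs where

open import Level using (Level; suc; _⊔_)
open import Data.Nat using (ℕ; zero) renaming (suc to sucℕ)
open import Data.Fin using (Fin) renaming (_<_ to _<ᶠ_)
import Data.Fin as F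
open import Data.List using (List; foldr)
open import Data.List.Relation.Unary.All using (All)
open import Data.List.Relation.Unary.Unique.Propositional using (Unique)
open import Data.Product using (Σ; ∃; _×_)
open import Data.Sum using (_⊎_)
open import Relation.Nullary using (¬_)
open import Relation.Binary.PropositionalEquality using (_≡_)
open import Relation.Binary.Structures using (IsTotalOrder)
open import Algebra.Structures using (IsCommutativeRing)

-- An ordered field (the real numbers ℝ are an instance).
record OrderedField (c ℓ : Level) : Set (suc (c ⊔ ℓ)) where
  infix  4 _≈_ _≤_ _<_
  infixl 6 _+_ _-_
  infixl 7 _*_
  field
    Carrier : Set c
    _≈_     : Carrier → Carrier → Set ℓ
    _≤_     : Carrier → Carrier → Set ℓ
    _+_     : Carrier → Carrier → Carrier
    _*_     : Carrier → Carrier → Carrier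
    -_      : Carrier → Carrier
    0#      : Carrier
    1#      : Carrier
    isCommutativeRing : IsCommutativeRing _≈_ _+_ _*_ -_ 0# 1#
    isTotalOrder      : IsTotalOrder _≈_ _≤_
    0≉1     : ¬ (0# ≈ 1#)
    inverse : ∀ x → ¬ (x ≈ 0#) → Σ Carrier (λ y → (x * y) ≈ 1#)
    +-monoˡ-≤ : ∀ {x y} z → x ≤ y → (x + z) ≤ (y + z)
    *-nonneg  : ∀ {x y} → 0# ≤ x → 0# ≤ y → 0# ≤ (x * y)

  _-_ : Carrier → Carrier → Carrier
  x - y = x + (- y)

  _<_ : Carrier → Carrier → Set ℓ
  x < y = (x ≤ y) × ¬ (x ≈ y)

record Edge (n : ℕ) : Set where
  constructor edge
  field
    i j k : Fin n
    i<j   : i <ᶠ j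
    j<k   : j <ᶠ k

record ThreeGraph (n : ℕ) : Set where
  field
    edges  : List (Edge n)
    unique : Unique edges

_∈ₑ_ : ∀ {n} → Fin n → Edge n → Set
v ∈ₑ e = (v ≡ Edge.i e) ⊎ (v ≡ Edge.j e) ⊎ (v ≡ Edge.k e)

IsStar : ∀ {n} → ThreeGraph n → Set
IsStar {n} G = ∃ λ (v : Fin n) → All (v ∈ₑ_) (ThreeGraph.edges G)

module _ {c ℓ} (𝔽 : OrderedField c ℓ) where
  open OrderedField 𝔽

  sumᶠ : ∀ {n} → (Fin n → Carrier) → Carrier
  sumᶠ {zero}   x = 0#
  sumᶠ {sucℕ n} x = x F.zero + sumᶠ (λ i → x (F.suc i))

  lagr : ∀ {n} → ThreeGraph n → (Fin n → Carrier) → Carrier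
  lagr G x = foldr (λ e acc → x (Edge.i e) * x (Edge.j e) * x (Edge.k e) + acc) 0#
                   (ThreeGraph.edges G)

  Feasible : ∀ {n} → (Fin n → Carrier) → Set ℓ
  Feasible x = (∀ i → 0# ≤ x i) × (sumᶠ x ≈ 1#)

  Bounded : ∀ {n} → Carrier → (Fin n → Carrier) → Set ℓ
  Bounded b x = ∀ i → x i ≤ b

-- Let v be the centre of the star and y the weighting x with y_v = 0. Every edge is
-- {v, a, b}, so 2λ(G, x) = x_v · Σ y_a y_b over both orientations (a, b), (b, a) of the
-- links {a, b} of the edges. Distinct edges have distinct links, so this sum is at most
-- (Σ y)² = (1 - x_v)². Finally t (1 - t)² is increasing on [0, 1/3], which contains x_v ≤ b.
module Submission where

open import Defs
open import Data.Nat using (ℕ)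
open import Data.Fin as Fin using (Fin; zero; suc) renaming (_<_ to _<ᶠ_)
import Data.Fin.Properties as Fin
open import Data.Product using (_×_; _,_; proj₁; proj₂; swap)
open import Data.Sum using (inj₁; inj₂)
open import Data.List using (List; []; _∷_; _++_; foldr; map; allFin; tabulate; cartesianProduct)
open import Data.List.Relation.Unary.All as All using (All; []; _∷_)
open import Data.List.Relation.Unary.Any using (here; there)
open import Data.List.Relation.Unary.AllPairs using ([]; _∷_)
open import Data.List.Relation.Unary.Unique.Propositional using (Unique)
import Data.List.Relation.Unary.Unique.Propositional.Properties as Unique
open import Data.List.Relation.Binary.Disjoint.Propositional using (Disjoint)
open import Data.List.Relation.Binary.Subset.Propositional using (_⊆_)
open import Data.List.Membership.Propositional using (_∈_)
open import Data.List.Membership.Propositional.Properties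
  using (∈-∃++; ∈-map⁻; ∈-allFin; ∈-cartesianProduct⁺)
open import Data.Vec.Functional using (updateAt)
open import Data.Vec.Functional.Properties using (updateAt-updates; updateAt-minimal)
open import Function using (id; _∘_; const)
open import Relation.Nullary using (yes; no; contradiction)
open import Relation.Binary.Bundles using (Poset)
open import Relation.Binary.Structures using (IsTotalOrder)
open import Relation.Binary.PropositionalEquality as ≡ using (_≡_; _≢_; refl; cong; cong₂; ≢-sym)
open import Algebra.Bundles using (CommutativeRing)
open import Algebra.Structures using (IsCommutativeRing)

module _ {n : ℕ} (v : Fin n) where

  link : (e : Edge n) → v ∈ₑ e → Fin n × Fin n
  link (edge i j k _ _) (inj₁ _)        = j , k
  link (edge i j k _ _) (inj₂ (inj₁ _)) = i , k
  link (edge i j k _ _) (inj₂ (inj₂ _)) = i , j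

  link-ordered : ∀ e (p : v ∈ₑ e) → proj₁ (link e p) <ᶠ proj₂ (link e p)
  link-ordered (edge i j k i<j j<k) (inj₁ _)        = j<k
  link-ordered (edge i j k i<j j<k) (inj₂ (inj₁ _)) = Fin.<-trans i<j j<k
  link-ordered (edge i j k i<j j<k) (inj₂ (inj₂ _)) = i<j

  link-avoids : ∀ e (p : v ∈ₑ e) → proj₁ (link e p) ≢ v × proj₂ (link e p) ≢ v
  link-avoids (edge i j k i<j j<k) (inj₁ refl) =
    ≢-sym (Fin.<⇒≢ i<j) , ≢-sym (Fin.<⇒≢ (Fin.<-trans i<j j<k))
  link-avoids (edge i j k i<j j<k) (inj₂ (inj₁ refl)) = Fin.<⇒≢ i<j , ≢-sym (Fin.<⇒≢ j<k)
  link-avoids (edge i j k i<j j<k) (inj₂ (inj₂ refl)) =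
    Fin.<⇒≢ (Fin.<-trans i<j j<k) , Fin.<⇒≢ j<k

  edge-≡ : ∀ {i j k : Fin n} (i<j i<j′ : i <ᶠ j) (j<k j<k′ : j <ᶠ k) → edge i j k i<j j<k ≡ edge i j k i<j′ j<k′
  edge-≡ i<j i<j′ j<k j<k′ = cong₂ (edge _ _ _) (Fin.<-irrelevant i<j i<j′) (Fin.<-irrelevant j<k j<k′)

  -- An edge through v is v together with its link, and the ordering of the
  -- edge's vertices pins down where v sits; the mixed cases contradict it.
  link-injective : ∀ e (p : v ∈ₑ e) e′ (p′ : v ∈ₑ e′) → link e p ≡ link e′ p′ → e ≡ e′
  link-injective (edge _ _ _ a b) (inj₁ refl)        (edge _ _ _ a′ b′) (inj₁ refl)        refl = edge-≡ a a′ b b′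
  link-injective (edge _ _ _ a b) (inj₂ (inj₁ refl)) (edge _ _ _ a′ b′) (inj₂ (inj₁ refl)) refl = edge-≡ a a′ b b′
  link-injective (edge _ _ _ a b) (inj₂ (inj₂ refl)) (edge _ _ _ a′ b′) (inj₂ (inj₂ refl)) refl = edge-≡ a a′ b b′
  link-injective (edge _ _ _ a b) (inj₁ refl)        (edge _ _ _ a′ b′) (inj₂ (inj₁ refl)) refl =
    contradiction a′ (Fin.<-asym a)
  link-injective (edge _ _ _ a b) (inj₁ refl)        (edge _ _ _ a′ b′) (inj₂ (inj₂ refl)) refl =
    contradiction b′ (Fin.<-asym (Fin.<-trans a b))
  link-injective (edge _ _ _ a b) (inj₂ (inj₁ refl)) (edge _ _ _ a′ b′) (inj₁ refl)        refl =
    contradiction a′ (Fin.<-asym a)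
  link-injective (edge _ _ _ a b) (inj₂ (inj₁ refl)) (edge _ _ _ a′ b′) (inj₂ (inj₂ refl)) refl =
    contradiction b′ (Fin.<-asym b)
  link-injective (edge _ _ _ a b) (inj₂ (inj₂ refl)) (edge _ _ _ a′ b′) (inj₁ refl)        refl =
    contradiction b (Fin.<-asym (Fin.<-trans a′ b′))
  link-injective (edge _ _ _ a b) (inj₂ (inj₂ refl)) (edge _ _ _ a′ b′) (inj₂ (inj₁ refl)) refl =
    contradiction b′ (Fin.<-asym b)

  links : ∀ {es} → All (v ∈ₑ_) es → List (Fin n × Fin n)
  links = All.reduce (λ {e} → link e)

  links-ordered : ∀ {es} (ps : All (v ∈ₑ_) es) → All (λ q → proj₁ q <ᶠ proj₂ q) (links ps)
  links-ordered []       = []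
  links-ordered (p ∷ ps) = link-ordered _ p ∷ links-ordered ps

  links-unique : ∀ {es} (ps : All (v ∈ₑ_) es) → Unique es → Unique (links ps)
  links-unique []       []                = []
  links-unique (p ∷ ps) (e∉ ∷ es-unique) = fresh ps e∉ ∷ links-unique ps es-unique
    where
    fresh : ∀ {e es} {p : v ∈ₑ e} (ps : All (v ∈ₑ_) es) → All (e ≢_) es → All (link e p ≢_) (links ps)
    fresh []         []         = []
    fresh (p′ ∷ ps′) (e≢ ∷ e∉′) = (e≢ ∘ link-injective _ _ _ p′) ∷ fresh ps′ e∉′

ordered-disjoint-swapped : ∀ {n} {qs : List (Fin n × Fin n)} →
  All (λ q → proj₁ q <ᶠ proj₂ q) qs → Disjoint qs (map swap qs)
ordered-disjoint-swapped ordered (q∈qs , q∈swapped) with ∈-map⁻ swap q∈swapped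
... | q′ , q′∈qs , refl = Fin.<-asym (All.lookup ordered q∈qs) (All.lookup ordered q′∈qs)

∈-++-skip : ∀ {a} {A : Set a} {x y : A} ys {zs} → x ≢ y → x ∈ ys ++ y ∷ zs → x ∈ ys ++ zs
∈-++-skip []       x≢y (here x≡y) = contradiction x≡y x≢y
∈-++-skip []       x≢y (there x∈) = x∈
∈-++-skip (_ ∷ ys) x≢y (here x≡y) = here x≡y
∈-++-skip (_ ∷ ys) x≢y (there x∈) = there (∈-++-skip ys x≢y x∈)

module OrderedFieldProperties {c ℓ} (𝔽 : OrderedField c ℓ) where

  open OrderedField 𝔽
  open IsCommutativeRing isCommutativeRing hiding (_-_; zero) renaming (refl to ≈-refl)
  open IsTotalOrder isTotalOrder using () renaming (trans to ≤-trans; reflexive to ≤-reflexive)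

  commutativeRing : CommutativeRing c ℓ
  commutativeRing = record { isCommutativeRing = isCommutativeRing }

  poset : Poset c ℓ ℓ
  poset = record { isPartialOrder = IsTotalOrder.isPartialOrder isTotalOrder }

  open CommutativeRing commutativeRing using (+-group; +-commutativeSemigroup; *-commutativeSemigroup)
  open import Algebra.Properties.Group +-group using (//-rightDividesˡ; //-rightDividesʳ)
  open import Algebra.Properties.CommutativeSemigroup +-commutativeSemigroup
    using () renaming (x∙yz≈y∙xz to x+[y+z]≈y+[x+z])
  open import Algebra.Properties.CommutativeSemigroup *-commutativeSemigroup
    using () renaming (x∙yz≈y∙xz to x*[y*z]≈y*[x*z])
  open import Algebra.Solver.Ring.NaturalCoefficients.Default
    (CommutativeRing.commutativeSemiring commutativeRing) using (solve; _:=_; _:+_; _:*_)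
  open import Relation.Binary.Reasoning.PartialOrder poset public

  +-monoʳ-≤ : ∀ z {x y} → x ≤ y → z + x ≤ z + y
  +-monoʳ-≤ z {x} {y} x≤y = begin
    z + x ≈⟨ +-comm z x ⟩
    x + z ≤⟨ +-monoˡ-≤ z x≤y ⟩
    y + z ≈⟨ +-comm y z ⟩
    z + y ∎

  x≤x+y : ∀ x {y} → 0# ≤ y → x ≤ x + y
  x≤x+y x {y} 0≤y = begin
    x      ≈⟨ +-identityʳ x ⟨
    x + 0# ≤⟨ +-monoʳ-≤ x 0≤y ⟩
    x + y  ∎

  +-nonNeg : ∀ {x y} → 0# ≤ x → 0# ≤ y → 0# ≤ x + y
  +-nonNeg {x} 0≤x 0≤y = ≤-trans 0≤x (x≤x+y x 0≤y)

  x≤y⇒0≤y-x : ∀ {x y} → x ≤ y → 0# ≤ y - x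
  x≤y⇒0≤y-x {x} {y} x≤y = begin
    0#    ≈⟨ -‿inverseʳ x ⟨
    x - x ≤⟨ +-monoˡ-≤ (- x) x≤y ⟩
    y - x ∎

  *-monoʳ-≤-nonNeg : ∀ {z x y} → 0# ≤ z → x ≤ y → z * x ≤ z * y
  *-monoʳ-≤-nonNeg {z} {x} {y} 0≤z x≤y = begin
    z * x               ≤⟨ x≤x+y (z * x) (*-nonneg 0≤z (x≤y⇒0≤y-x x≤y)) ⟩
    z * x + z * (y - x) ≈⟨ distribˡ z x (y - x) ⟨
    z * (x + (y - x))   ≈⟨ *-congˡ (+-comm x (y - x)) ⟩
    z * ((y - x) + x)   ≈⟨ *-congˡ (//-rightDividesˡ x y) ⟩
    z * y               ∎

  x≈y+z⇒x-z≈y : ∀ {x y z} → x ≈ y + z → x - z ≈ y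
  x≈y+z⇒x-z≈y {x} {y} {z} x≈y+z = trans (+-congʳ x≈y+z) (//-rightDividesʳ z y)

  [1+1]*x≈x+x : ∀ x → (1# + 1#) * x ≈ x + x
  [1+1]*x≈x+x x = trans (distribʳ x 1# 1#) (+-cong (*-identityˡ x) (*-identityˡ x))

  [1+1+1]*x≈x+x+x : ∀ x → (1# + 1# + 1#) * x ≈ x + x + x
  [1+1+1]*x≈x+x+x x = trans (distribʳ x (1# + 1#) 1#) (+-cong ([1+1]*x≈x+x x) (*-identityˡ x))

  -- s ↦ s (1 - s)² is increasing on [0, 1/3]: with d = b - t and p = 1 - 3b,
  -- the difference of its values at b and t is d times a polynomial in t, d, p
  -- with nonnegative coefficients.
  t≤b⇒t[1-t]²≤b[1-b]² : ∀ {t b} → 0# ≤ t → t ≤ b → (1# + 1# + 1#) * b ≤ 1# →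
                         t * (1# - t) * (1# - t) ≤ b * (1# - b) * (1# - b)
  t≤b⇒t[1-t]²≤b[1-b]² {t} {b} 0≤t t≤b 3b≤1 = begin
    t * (1# - t) * (1# - t)             ≈⟨ *-cong (*-congˡ 1-t≈d+A) 1-t≈d+A ⟩
    t * (d + A) * (d + A)               ≤⟨ x≤x+y _ (*-nonneg 0≤d 0≤Q) ⟩
    t * (d + A) * (d + A) + d * Q       ≈⟨ polynomial-identity t d p ⟨
    (d + t) * A * A                     ≈⟨ *-cong (*-cong b≈d+t 1-b≈A) 1-b≈A ⟨
    b * (1# - b) * (1# - b)             ∎
    where
    d p A Q : Carrier
    d = b - t
    p = 1# - (1# + 1# + 1#) * b
    A = p + ((d + t) + (d + t))
    Q = t * d + t * d + t * d + t * p + t * p + (d + d + p) * (d + d + p)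
    0≤d : 0# ≤ d
    0≤d = x≤y⇒0≤y-x t≤b
    0≤p : 0# ≤ p
    0≤p = x≤y⇒0≤y-x 3b≤1
    0≤Q : 0# ≤ Q
    0≤Q = +-nonNeg (+-nonNeg (+-nonNeg (+-nonNeg (+-nonNeg td td) td) tp) tp) (*-nonneg 0≤2d+p 0≤2d+p)
      where
      td : 0# ≤ t * d
      td = *-nonneg 0≤t 0≤d
      tp : 0# ≤ t * p
      tp = *-nonneg 0≤t 0≤p
      0≤2d+p : 0# ≤ d + d + p
      0≤2d+p = +-nonNeg (+-nonNeg 0≤d 0≤d) 0≤p
    b≈d+t : b ≈ d + t
    b≈d+t = sym (//-rightDividesˡ t b)
    1≈A+b : 1# ≈ A + b
    1≈A+b = begin-equality
      1#                          ≈⟨ //-rightDividesˡ ((1# + 1# + 1#) * b) 1# ⟨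
      p + (1# + 1# + 1#) * b      ≈⟨ +-congˡ ([1+1+1]*x≈x+x+x b) ⟩
      p + (b + b + b)             ≈⟨ solve 2 (λ p b → p :+ (b :+ b :+ b) := p :+ (b :+ b) :+ b) ≈-refl p b ⟩
      p + (b + b) + b             ≈⟨ +-congʳ (+-congˡ (+-cong b≈d+t b≈d+t)) ⟩
      A + b                       ∎
    1-b≈A : 1# - b ≈ A
    1-b≈A = x≈y+z⇒x-z≈y 1≈A+b
    1-t≈d+A : 1# - t ≈ d + A
    1-t≈d+A = x≈y+z⇒x-z≈y (trans 1≈A+b (trans (+-congˡ b≈d+t)
                (solve 3 (λ a d t → a :+ (d :+ t) := d :+ a :+ t) ≈-refl A d t)))
    polynomial-identity : ∀ t d p → let A = p + ((d + t) + (d + t)) in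
      (d + t) * A * A ≈
      t * (d + A) * (d + A) + d * (t * d + t * d + t * d + t * p + t * p + (d + d + p) * (d + d + p))
    polynomial-identity = solve 3 (λ t d p → let A = p :+ ((d :+ t) :+ (d :+ t)) in
      (d :+ t) :* A :* A :=
      t :* (d :+ A) :* (d :+ A) :+ d :* (t :* d :+ t :* d :+ t :* d :+ t :* p :+ t :* p :+ (d :+ d :+ p) :* (d :+ d :+ p))) ≈-refl

  lsum : ∀ {a} {A : Set a} → (A → Carrier) → List A → Carrier
  lsum w = foldr (λ a s → w a + s) 0#

  module _ {a} {A : Set a} where

    lsum-nonNeg : ∀ {w : A → Carrier} → (∀ a → 0# ≤ w a) → ∀ xs → 0# ≤ lsum w xs
    lsum-nonNeg 0≤w []       = ≤-reflexive ≈-refl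
    lsum-nonNeg 0≤w (x ∷ xs) = +-nonNeg (0≤w x) (lsum-nonNeg 0≤w xs)

    lsum-cong : ∀ {w w′ : A → Carrier} → (∀ a → w a ≈ w′ a) → ∀ xs → lsum w xs ≈ lsum w′ xs
    lsum-cong w≈w′ []       = ≈-refl
    lsum-cong w≈w′ (x ∷ xs) = +-cong (w≈w′ x) (lsum-cong w≈w′ xs)

    lsum-++ : ∀ (w : A → Carrier) xs ys → lsum w (xs ++ ys) ≈ lsum w xs + lsum w ys
    lsum-++ w []       ys = sym (+-identityˡ (lsum w ys))
    lsum-++ w (x ∷ xs) ys = trans (+-congˡ (lsum-++ w xs ys)) (sym (+-assoc (w x) (lsum w xs) (lsum w ys)))

    lsum-*ˡ : ∀ (w : A → Carrier) z xs → lsum (λ a → z * w a) xs ≈ z * lsum w xs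
    lsum-*ˡ w z []       = sym (zeroʳ z)
    lsum-*ˡ w z (x ∷ xs) = trans (+-congˡ (lsum-*ˡ w z xs)) (sym (distribˡ z (w x) (lsum w xs)))

    lsum-insert : ∀ (w : A → Carrier) ys {x zs} → lsum w (ys ++ x ∷ zs) ≈ w x + lsum w (ys ++ zs)
    lsum-insert w []       = ≈-refl
    lsum-insert w (y ∷ ys) {x} {zs} =
      trans (+-congˡ (lsum-insert w ys)) (x+[y+z]≈y+[x+z] (w y) (w x) (lsum w (ys ++ zs)))

    -- Each element of a duplicate-free xs can be taken out of ys in turn.
    lsum-mono-⊆ : ∀ {w : A → Carrier} → (∀ a → 0# ≤ w a) →
                  ∀ {xs ys} → Unique xs → xs ⊆ ys → lsum w xs ≤ lsum w ys
    lsum-mono-⊆ 0≤w {[]} {ys} _ _ = lsum-nonNeg 0≤w ys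
    lsum-mono-⊆ {w} 0≤w {x ∷ xs} (x∉xs ∷ xs-unique) x∷xs⊆ys with ∈-∃++ (x∷xs⊆ys (here refl))
    ... | ys₁ , ys₂ , refl = begin
      w x + lsum w xs           ≤⟨ +-monoʳ-≤ (w x) (lsum-mono-⊆ 0≤w xs-unique xs⊆ys₁++ys₂) ⟩
      w x + lsum w (ys₁ ++ ys₂) ≈⟨ lsum-insert w ys₁ ⟨
      lsum w (ys₁ ++ x ∷ ys₂)   ∎
      where
      xs⊆ys₁++ys₂ : xs ⊆ ys₁ ++ ys₂
      xs⊆ys₁++ys₂ z∈xs = ∈-++-skip ys₁ (≢-sym (All.lookup x∉xs z∈xs)) (x∷xs⊆ys (there z∈xs))

  lsum-map : ∀ {a b} {A : Set a} {B : Set b} (w : B → Carrier) (f : A → B) xs →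
             lsum w (map f xs) ≡ lsum (w ∘ f) xs
  lsum-map w f []       = refl
  lsum-map w f (x ∷ xs) = cong (w (f x) +_) (lsum-map w f xs)

  lsum-tabulate : ∀ {a} {A : Set a} {n} (w : A → Carrier) (f : Fin n → A) →
                  lsum w (tabulate f) ≡ sumᶠ 𝔽 (w ∘ f)
  lsum-tabulate {n = ℕ.zero}  w f = refl
  lsum-tabulate {n = ℕ.suc n} w f = cong (w (f zero) +_) (lsum-tabulate w (f ∘ suc))

  pairProduct : ∀ {a} {A : Set a} → (A → Carrier) → A × A → Carrier
  pairProduct y (a , b) = y a * y b

  module _ {a} {A : Set a} (y : A → Carrier) where

    lsum-cartesianProduct : ∀ xs zs → lsum (pairProduct y) (cartesianProduct xs zs) ≈ lsum y xs * lsum y zs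
    lsum-cartesianProduct []       zs = sym (zeroˡ (lsum y zs))
    lsum-cartesianProduct (x ∷ xs) zs = begin-equality
      lsum (pairProduct y) (map (x ,_) zs ++ cartesianProduct xs zs)
        ≈⟨ lsum-++ (pairProduct y) (map (x ,_) zs) (cartesianProduct xs zs) ⟩
      lsum (pairProduct y) (map (x ,_) zs) + lsum (pairProduct y) (cartesianProduct xs zs)
        ≡⟨ cong (_+ _) (lsum-map (pairProduct y) (x ,_) zs) ⟩
      lsum (λ z → y x * y z) zs + lsum (pairProduct y) (cartesianProduct xs zs)
        ≈⟨ +-cong (lsum-*ˡ y (y x) zs) (lsum-cartesianProduct xs zs) ⟩
      y x * lsum y zs + lsum y xs * lsum y zs
        ≈⟨ distribʳ (lsum y zs) (y x) (lsum y xs) ⟨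
      (y x + lsum y xs) * lsum y zs ∎

    lsum-map-swap : ∀ qs → lsum (pairProduct y) (map swap qs) ≈ lsum (pairProduct y) qs
    lsum-map-swap qs = begin-equality
      lsum (pairProduct y) (map swap qs)   ≡⟨ lsum-map (pairProduct y) swap qs ⟩
      lsum (pairProduct y ∘ swap) qs       ≈⟨ lsum-cong (λ (a , b) → *-comm (y b) (y a)) qs ⟩
      lsum (pairProduct y) qs              ∎

  module _ {n} (y : Fin n → Carrier) (0≤y : ∀ u → 0# ≤ y u) where

    -- A duplicate-free list of increasing pairs, together with its mirror
    -- image, lists each ordered pair at most once.
    pairSum+pairSum≤sumᶠ² : ∀ {qs} → Unique qs → All (λ q → proj₁ q <ᶠ proj₂ q) qs →
      lsum (pairProduct y) qs + lsum (pairProduct y) qs ≤ sumᶠ 𝔽 y * sumᶠ 𝔽 y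
    pairSum+pairSum≤sumᶠ² {qs} qs-unique ordered = begin
      lsum (pairProduct y) qs + lsum (pairProduct y) qs
        ≈⟨ +-congˡ (lsum-map-swap y qs) ⟨
      lsum (pairProduct y) qs + lsum (pairProduct y) (map swap qs)
        ≈⟨ lsum-++ (pairProduct y) qs (map swap qs) ⟨
      lsum (pairProduct y) (qs ++ map swap qs)
        ≤⟨ lsum-mono-⊆ 0≤yy unique-qs++swapped (λ _ → ∈-cartesianProduct⁺ (∈-allFin _) (∈-allFin _)) ⟩
      lsum (pairProduct y) (cartesianProduct (allFin n) (allFin n))
        ≈⟨ lsum-cartesianProduct y (allFin n) (allFin n) ⟩
      lsum y (allFin n) * lsum y (allFin n)
        ≡⟨ cong₂ _*_ (lsum-tabulate y id) (lsum-tabulate y id) ⟩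
      sumᶠ 𝔽 y * sumᶠ 𝔽 y ∎
      where
      0≤yy : ∀ q → 0# ≤ pairProduct y q
      0≤yy (a , b) = *-nonneg (0≤y a) (0≤y b)
      unique-qs++swapped : Unique (qs ++ map swap qs)
      unique-qs++swapped = Unique.++⁺ qs-unique (Unique.map⁺ (cong swap) qs-unique) (ordered-disjoint-swapped ordered)

  sumᶠ-updateAt-0# : ∀ {n} (x : Fin n → Carrier) v → sumᶠ 𝔽 x ≈ x v + sumᶠ 𝔽 (updateAt x v (const 0#))
  sumᶠ-updateAt-0# {ℕ.suc n} x zero    = +-congˡ (sym (+-identityˡ (sumᶠ 𝔽 (x ∘ suc))))
  sumᶠ-updateAt-0# {ℕ.suc n} x (suc v) = begin-equality
    x zero + sumᶠ 𝔽 (x ∘ suc)                                 ≈⟨ +-congˡ (sumᶠ-updateAt-0# (x ∘ suc) v) ⟩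
    x zero + (x (suc v) + sumᶠ 𝔽 (updateAt (x ∘ suc) v _))    ≈⟨ x+[y+z]≈y+[x+z] (x zero) (x (suc v)) _ ⟩
    x (suc v) + (x zero + sumᶠ 𝔽 (updateAt (x ∘ suc) v _))    ∎

  updateAt-0#-nonNeg : ∀ {n} {x : Fin n → Carrier} → (∀ u → 0# ≤ x u) → ∀ v u → 0# ≤ updateAt x v (const 0#) u
  updateAt-0#-nonNeg {x = x} 0≤x v u with u Fin.≟ v
  ... | yes refl = ≡.subst (0# ≤_) (≡.sym (updateAt-updates u x)) (≤-reflexive ≈-refl)
  ... | no u≢v   = ≡.subst (0# ≤_) (≡.sym (updateAt-minimal u v x u≢v)) (0≤x u)

  module _ {n} (v : Fin n) (x : Fin n → Carrier) where

    edgeProduct-link : ∀ e (p : v ∈ₑ e) →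
      x (Edge.i e) * x (Edge.j e) * x (Edge.k e) ≈ x v * pairProduct x (link v e p)
    edgeProduct-link (edge _ j k _ _) (inj₁ refl)        = *-assoc (x v) (x j) (x k)
    edgeProduct-link (edge i _ k _ _) (inj₂ (inj₁ refl)) =
      trans (*-assoc (x i) (x v) (x k)) (x*[y*z]≈y*[x*z] (x i) (x v) (x k))
    edgeProduct-link (edge i j _ _ _) (inj₂ (inj₂ refl)) = *-comm (x i * x j) (x v)

    lagr-star : ∀ (G : ThreeGraph n) (ps : All (v ∈ₑ_) (ThreeGraph.edges G)) →
      lagr 𝔽 G x ≈ x v * lsum (pairProduct (updateAt x v (const 0#))) (links v ps)
    lagr-star G = go (ThreeGraph.edges G)
      where
      y : Fin n → Carrier
      y = updateAt x v (const 0#)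
      link-weight : ∀ e (p : v ∈ₑ e) → pairProduct x (link v e p) ≈ pairProduct y (link v e p)
      link-weight e p with link-avoids v e p
      ... | a≢v , b≢v = ≡.subst₂ (λ s t → _ ≈ s * t)
        (≡.sym (updateAt-minimal _ v x a≢v)) (≡.sym (updateAt-minimal _ v x b≢v)) ≈-refl
      go : ∀ es (ps : All (v ∈ₑ_) es) →
        lsum (λ e → x (Edge.i e) * x (Edge.j e) * x (Edge.k e)) es ≈ x v * lsum (pairProduct y) (links v ps)
      go []       []       = sym (zeroʳ (x v))
      go (e ∷ es) (p ∷ ps) = begin-equality
        x (Edge.i e) * x (Edge.j e) * x (Edge.k e) + _   ≈⟨ +-cong (edgeProduct-link e p) (go es ps) ⟩
        x v * pairProduct x (link v e p) + _             ≈⟨ +-congʳ (*-congˡ (link-weight e p)) ⟩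
        x v * pairProduct y (link v e p) + _             ≈⟨ distribˡ (x v) _ _ ⟨
        x v * lsum (pairProduct y) (links v (p ∷ ps))    ∎

lemma4p11 : ∀ {c ℓ} (𝔽 : OrderedField c ℓ) → let open OrderedField 𝔽 in
  (b : Carrier) → 0# < b → ((1# + 1# + 1#) * b) ≤ 1# →
  (n : ℕ) (G : ThreeGraph n) → IsStar G →
  (x : Fin n → Carrier) → Feasible 𝔽 x → Bounded 𝔽 b x →
  ((1# + 1#) * lagr 𝔽 G x) ≤ (b * (1# - b) * (1# - b))
lemma4p11 𝔽 b _ 3b≤1 n G (v , ps) x (0≤x , ∑x≈1) x≤b = begin
  (1# + 1#) * lagr 𝔽 G x                  ≈⟨ [1+1]*x≈x+x (lagr 𝔽 G x) ⟩
  lagr 𝔽 G x + lagr 𝔽 G x                 ≈⟨ +-cong (lagr-star v x G ps) (lagr-star v x G ps) ⟩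
  x v * H + x v * H                        ≈⟨ distribˡ (x v) H H ⟨
  x v * (H + H)                            ≤⟨ *-monoʳ-≤-nonNeg (0≤x v) (pairSum+pairSum≤sumᶠ² y 0≤y
                                                (links-unique v ps (ThreeGraph.unique G)) (links-ordered v ps)) ⟩
  x v * (S * S)                            ≈⟨ *-assoc (x v) S S ⟨
  x v * S * S                              ≈⟨ *-cong (*-congˡ S≈1-xᵥ) S≈1-xᵥ ⟩
  x v * (1# - x v) * (1# - x v)            ≤⟨ t≤b⇒t[1-t]²≤b[1-b]² (0≤x v) (x≤b v) 3b≤1 ⟩
  b * (1# - b) * (1# - b)                  ∎
  where
  open OrderedField 𝔽
  open IsCommutativeRing isCommutativeRing using (sym; trans; +-comm; +-cong; *-cong; *-congˡ; *-assoc; distribˡ)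
  open OrderedFieldProperties 𝔽
  y : Fin n → Carrier
  y = updateAt x v (const 0#)
  0≤y : ∀ u → 0# ≤ y u
  0≤y = updateAt-0#-nonNeg 0≤x v
  H S : Carrier
  H = lsum (pairProduct y) (links v ps)
  S = sumᶠ 𝔽 y
  S≈1-xᵥ : S ≈ 1# - x v
  S≈1-xᵥ = sym (x≈y+z⇒x-z≈y (trans (sym ∑x≈1) (trans (sumᶠ-updateAt-0# x v) (+-comm (x v) S))))
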